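{- For every ordered graph $H$ and every $\varepsilon>0$ there exists $\delta>0$ such that for every ordered graph $G$ that does not contain $H$, there exists $X\subseteq V(G)$ with $|X|\ge \delta|G|$ such that in one of $G[X]$, $\overline{G}[X]$, every vertex in $X$ has degree less than $\varepsilon|X|$.
   Context: All graphs are finite, without loops or parallel edges; $|G|$ denotes the number of vertices of $G$. An ordered graph is a graph with a linear order on its vertex set; induced subgraphs inherit the order. $\overline{G}$ denotes the complement graph (with the same vertex order). An ordered graph $G$ contains an ordered graph $H$ if $H$ is isomorphic to an induced subgraph $H'$ of $G$ via an isomorphism carrying the order of $V(H)$ to the inherited order of $V(H')$. -}

module Defs where

open import Data.Bool using (Bool; true; false; not; if_then_else_)
open import Data.Nat using (ℕ)
open import Data.Fin using (Fin; _<_)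
open import Data.Fin.Subset using (Subset; _∈_; _∩_; ∣_∣)
open import Data.Fin.Properties using (_≟_)
open import Data.Vec using (tabulate)
open import Data.Integer using (+_)
open import Data.Rational using (ℚ; _/_; _*_) renaming (_<_ to _<ℚ_; _≤_ to _≤ℚ_)
open import Data.Product using (Σ; _×_)
open import Relation.Nullary using (¬_; Dec; yes; no)
open import Relation.Binary.PropositionalEquality using (_≡_)

ℕtoℚ : ℕ → ℚ
ℕtoℚ n = (+ n) / 1

-- An ordered graph on n vertices: vertex set Fin n with its natural order,
-- symmetric irreflexive adjacency (no loops, no parallel edges).
record OGraph (n : ℕ) : Set where
  field
    adj    : Fin n → Fin n → Bool
    sym    : ∀ i j → adj i j ≡ adj j i
    irrefl : ∀ i → adj i i ≡ false
open OGraph public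

complement : ∀ {n} → OGraph n → OGraph n
complement {n} G = record { adj = a ; sym = s ; irrefl = r }
  where
  a : Fin n → Fin n → Bool
  a i j with i ≟ j
  ... | yes _ = false
  ... | no _  = not (adj G i j)
  s : ∀ i j → a i j ≡ a j i
  s i j with i ≟ j | j ≟ i
  ... | yes _ | yes _ = Relation.Binary.PropositionalEquality.refl
  ... | yes p | no q  = Data.Empty.⊥-elim (q (Relation.Binary.PropositionalEquality.sym p))
    where import Data.Empty
  ... | no p  | yes q = Data.Empty.⊥-elim (p (Relation.Binary.PropositionalEquality.sym q))
    where import Data.Empty
  ... | no _  | no _  = Relation.Binary.PropositionalEquality.cong not (sym G i j)
  r : ∀ i → a i i ≡ false
  r i with i ≟ i
  ... | yes _ = Relation.Binary.PropositionalEquality.refl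
  ... | no p  = Data.Empty.⊥-elim (p Relation.Binary.PropositionalEquality.refl)
    where import Data.Empty

-- G contains H: an order-preserving map V(H) → V(G) (strictly increasing,
-- hence injective) that is an isomorphism onto the induced subgraph.
Contains : ∀ {n k} → OGraph n → OGraph k → Set
Contains {n} {k} G H =
  Σ (Fin k → Fin n) λ f →
    (∀ i j → i < j → f i < f j) × (∀ i j → adj H i j ≡ adj G (f i) (f j))

nbhd : ∀ {n} → OGraph n → Fin n → Subset n
nbhd G v = tabulate (λ u → adj G v u)

degIn : ∀ {n} → OGraph n → Subset n → Fin n → ℕ
degIn G X v = ∣ X ∩ nbhd G v ∣

AllLowDegree : ∀ {n} → OGraph n → Subset n → ℚ → Set
AllLowDegree G X ε = ∀ v → v ∈ X → ℕtoℚ (degIn G X v) <ℚ ε * ℕtoℚ ∣ X ∣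

module Submission where

-- If G has no ordered copy of H, the greedy embedding of H into k + 1 consecutive blocks of a
-- vertex set fails, and the failure exhibits large sets A before B such that every vertex of A
-- has few neighbours (or few non-neighbours) in B.  Averaging over blocks of B and discarding the
-- heavy vertices of B turns this into two equal-sized sets that are sparse for one label (edge or
-- non-edge) in both directions.  Splitting recursively inside both halves builds a binary tree of
-- such pairs; after 2K levels one label owns K + 1 leaves that are pairwise sparse for it, and in
-- their union X every vertex has fewer than 2|X|/K neighbours of that label.  All losses depend
-- only on H and K, so the leaves, and hence X, have linear size.

module OrderedRödl where

  open import Defs hiding (sym)
  open import Data.Bool using (Bool; true; false; not; _∧_; _∨_; if_then_else_)
  open import Data.Bool.Properties using (∧-zeroʳ; ∧-identityʳ; not-¬) renaming (_≟_ to _≟ᵇ_)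
  open import Data.Empty using (⊥-elim)
  open import Data.Fin using (Fin; zero; suc) renaming (_<_ to _<ᶠ_)
  open import Data.Fin.Properties using (any?; all?; ¬∀⟶∃¬) renaming (_≟_ to _≟ᶠ_)
  open import Data.Fin.Subset using (Subset; _∈_; _∩_; ∣_∣)
  import Data.Integer as ℤ
  import Data.Integer.Properties as ℤ
  open import Data.List using (List; []; _∷_; _++_; length)
  open import Data.List.Properties using (length-++)
  open import Data.List.Relation.Unary.All as All using (All; []; _∷_)
  import Data.List.Relation.Unary.All.Properties as Allₚ
  open import Data.List.Relation.Unary.AllPairs as AllPairs using (AllPairs; []; _∷_)
  import Data.List.Relation.Unary.AllPairs.Properties as AllPairsₚ
  open import Data.Nat using (ℕ; zero; suc; _+_; _*_; _^_; _≤_; _<_; z≤n; s≤s; _≤?_; _<?_; NonZero; >-nonZero)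
  open import Data.Nat.Coprimality using (Coprime; 1-coprimeTo) renaming (sym to Coprime-sym)
  open import Data.Nat.DivMod using (_/_; _%_; m≡m%n+[m/n]*n; m%n<n; m/n*n≤m)
  open import Data.Nat.Properties
  open import Data.Nat.Tactic.RingSolver using (solve-∀)
  open import Data.Product using (Σ; _×_; _,_; proj₁; proj₂)
  open import Data.Rational using (ℚ; mkℚ; Positive) renaming (_<_ to _<ℚ_; _≤_ to _≤ℚ_; _*_ to _*ℚ_)
  open import Data.Rational.Properties using (↥p/↧p≡p; toℚᵘ-cancel-<; toℚᵘ-cancel-≤; toℚᵘ-homo-*)
  import Data.Rational.Unnormalised as ℚᵘ
  import Data.Rational.Unnormalised.Properties as ℚᵘ
  open import Data.Sum as Sum using (_⊎_; inj₁; inj₂)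
  open import Data.Vec using (tabulate; _∷_)
  open import Data.Vec.Properties using (lookup∘tabulate; []=⇒lookup)
  open import Function using (_∘_)
  open import Relation.Binary.PropositionalEquality using (_≡_; refl; sym; trans; cong; cong₂; subst; subst₂; module ≡-Reasoning)
  open import Relation.Nullary using (¬_; Dec; yes; no; does)
  open import Relation.Nullary.Decidable using (dec-true; _×-dec_)

  ∧-true : ∀ {a b} → a ∧ b ≡ true → a ≡ true × b ≡ true
  ∧-true {true} {true} _ = refl , refl

  not-true : ∀ {a} → not a ≡ true → a ≡ false
  not-true {false} _ = refl

  does-true : ∀ {P : Set} (d : Dec P) → does d ≡ true → P
  does-true (yes p) _ = p

  does-false : ∀ {P : Set} (d : Dec P) → does d ≡ false → ¬ P
  does-false (no ¬p) _ = ¬p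

  ∑ : ∀ {m} → (Fin m → ℕ) → ℕ
  ∑ {zero}  f = 0
  ∑ {suc m} f = f zero + ∑ (f ∘ suc)

  ∑-cong : ∀ {m} (f g : Fin m → ℕ) → (∀ i → f i ≡ g i) → ∑ f ≡ ∑ g
  ∑-cong {zero}  f g e = refl
  ∑-cong {suc m} f g e = cong₂ _+_ (e zero) (∑-cong (f ∘ suc) (g ∘ suc) (e ∘ suc))

  ∑-mono-≤ : ∀ {m} (f g : Fin m → ℕ) → (∀ i → f i ≤ g i) → ∑ f ≤ ∑ g
  ∑-mono-≤ {zero}  f g e = z≤n
  ∑-mono-≤ {suc m} f g e = +-mono-≤ (e zero) (∑-mono-≤ (f ∘ suc) (g ∘ suc) (e ∘ suc))

  ∑-zero : ∀ {m} (f : Fin m → ℕ) → (∀ i → f i ≡ 0) → ∑ f ≡ 0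
  ∑-zero {zero}  f e = refl
  ∑-zero {suc m} f e = cong₂ _+_ (e zero) (∑-zero (f ∘ suc) (e ∘ suc))

  ∑-distrib-+ : ∀ {m} (f g : Fin m → ℕ) → ∑ (λ i → f i + g i) ≡ ∑ f + ∑ g
  ∑-distrib-+ {zero}  f g = refl
  ∑-distrib-+ {suc m} f g =
    trans (cong (f zero + g zero +_) (∑-distrib-+ (f ∘ suc) (g ∘ suc)))
          (interchange (f zero) (g zero) _ _)
    where
    interchange : ∀ a b c d → a + b + (c + d) ≡ a + c + (b + d)
    interchange = solve-∀

  ∑-*ˡ : ∀ {m} c (f : Fin m → ℕ) → ∑ (λ i → c * f i) ≡ c * ∑ f
  ∑-*ˡ {zero}  c f = sym (*-zeroʳ c)
  ∑-*ˡ {suc m} c f = trans (cong (c * f zero +_) (∑-*ˡ c (f ∘ suc))) (sym (*-distribˡ-+ c (f zero) _))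

  ∑-comm : ∀ {a b} (g : Fin a → Fin b → ℕ) → ∑ (λ i → ∑ (g i)) ≡ ∑ (λ j → ∑ (λ i → g i j))
  ∑-comm {zero}  {b} g = sym (∑-zero {b} (λ _ → 0) (λ _ → refl))
  ∑-comm {suc a} {b} g =
    trans (cong (∑ (g zero) +_) (∑-comm (g ∘ suc)))
          (sym (∑-distrib-+ (g zero) (λ j → ∑ (λ i → g (suc i) j))))

  term≤∑ : ∀ {m} (f : Fin m → ℕ) j → f j ≤ ∑ f
  term≤∑ f zero    = m≤m+n _ _
  term≤∑ f (suc j) = ≤-trans (term≤∑ (f ∘ suc) j) (m≤n+m _ _)

  ∑≤*max : ∀ {m} (f : Fin m → ℕ) C → (∀ i → f i ≤ C) → ∑ f ≤ m * C
  ∑≤*max {zero}  f C h = z≤n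
  ∑≤*max {suc m} f C h = +-mono-≤ (h zero) (∑≤*max (f ∘ suc) C (h ∘ suc))

  *min≤∑ : ∀ {m} (f : Fin m → ℕ) C → (∀ i → C ≤ f i) → m * C ≤ ∑ f
  *min≤∑ {zero}  f C h = z≤n
  *min≤∑ {suc m} f C h = +-mono-≤ (h zero) (*min≤∑ (f ∘ suc) C (h ∘ suc))

  argmax : ∀ {k} (f : Fin (suc k) → ℕ) → Σ (Fin (suc k)) λ j → ∀ i → f i ≤ f j
  argmax {zero}  f = zero , λ { zero → ≤-refl }
  argmax {suc k} f with argmax (f ∘ suc)
  ... | j , h with f zero ≤? f (suc j)
  ...   | yes p = suc j , λ { zero → p ; (suc i) → h i }
  ...   | no  p = zero , λ { zero → ≤-refl ; (suc i) → ≤-trans (h i) (<⇒≤ (≰⇒> p)) }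

  argmin : ∀ {k} (f : Fin (suc k) → ℕ) → Σ (Fin (suc k)) λ j → ∀ i → f j ≤ f i
  argmin {zero}  f = zero , λ { zero → ≤-refl }
  argmin {suc k} f with argmin (f ∘ suc)
  ... | j , h with f (suc j) ≤? f zero
  ...   | yes p = suc j , λ { zero → p ; (suc i) → h i }
  ...   | no  p = zero , λ { zero → ≤-refl ; (suc i) → ≤-trans (<⇒≤ (≰⇒> p)) (h i) }

  ∃-above-average : ∀ {k} (f : Fin (suc k) → ℕ) → Σ (Fin (suc k)) λ j → ∑ f ≤ suc k * f j
  ∃-above-average f = let j , h = argmax f in j , ∑≤*max f (f j) h

  ∃-below-average : ∀ {k} (f : Fin (suc k) → ℕ) → Σ (Fin (suc k)) λ j → suc k * f j ≤ ∑ f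
  ∃-below-average f = let j , h = argmin f in j , *min≤∑ f (f j) h

  toℕᵇ : Bool → ℕ
  toℕᵇ true  = 1
  toℕᵇ false = 0

  count : ∀ {m} → (Fin m → Bool) → ℕ
  count P = ∑ (toℕᵇ ∘ P)

  _⊆_ : ∀ {m} → (Fin m → Bool) → (Fin m → Bool) → Set
  P ⊆ Q = ∀ i → P i ≡ true → Q i ≡ true

  count-cong : ∀ {m} (P Q : Fin m → Bool) → (∀ i → P i ≡ Q i) → count P ≡ count Q
  count-cong P Q e = ∑-cong _ _ (cong toℕᵇ ∘ e)

  count-mono : ∀ {m} (P Q : Fin m → Bool) → P ⊆ Q → count P ≤ count Q
  count-mono P Q h = ∑-mono-≤ _ _ (λ i → toℕᵇ-mono (h i))
    where
    toℕᵇ-mono : ∀ {a b} → (a ≡ true → b ≡ true) → toℕᵇ a ≤ toℕᵇ b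
    toℕᵇ-mono {false} h = z≤n
    toℕᵇ-mono {true}  h rewrite h refl = ≤-refl

  count-none : ∀ {m} (P : Fin m → Bool) → (∀ i → P i ≡ false) → count P ≡ 0
  count-none P h = ∑-zero _ (cong toℕᵇ ∘ h)

  count-all : ∀ {m} → count {m} (λ _ → true) ≡ m
  count-all {zero}  = refl
  count-all {suc m} = cong suc (count-all {m})

  count-split : ∀ {m} (P Q : Fin m → Bool) →
    count P ≡ count (λ i → P i ∧ Q i) + count (λ i → P i ∧ not (Q i))
  count-split {m} P Q = trans (∑-cong {m} _ _ (λ i → split (P i) (Q i))) (∑-distrib-+ {m} _ _)
    where
    split : ∀ a b → toℕᵇ a ≡ toℕᵇ (a ∧ b) + toℕᵇ (a ∧ not b)
    split false b     = refl
    split true  false = refl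
    split true  true  = refl

  toℕᵇ*count : ∀ {m} a (P : Fin m → Bool) → toℕᵇ a * count P ≡ count (λ i → a ∧ P i)
  toℕᵇ*count {m} false P = sym (count-none {m} _ (λ _ → refl))
  toℕᵇ*count true  P = +-identityʳ _

  markov : ∀ {m} (P : Fin m → Bool) (f : Fin m → ℕ) C →
    (∀ i → P i ≡ true → C ≤ f i) → C * count P ≤ ∑ f
  markov P f C h = ≤-trans (≤-reflexive (sym (∑-*ˡ C (toℕᵇ ∘ P)))) (∑-mono-≤ _ _ pointwise)
    where
    pointwise : ∀ i → C * toℕᵇ (P i) ≤ f i
    pointwise i with P i in e
    ... | false = ≤-trans (≤-reflexive (*-zeroʳ C)) z≤n
    ... | true  = ≤-trans (≤-reflexive (*-identityʳ C)) (h i e)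

  union-bound : ∀ {n k} (P : Fin n → Bool) (Q : Fin n → Fin k → Bool) →
    (∀ v → P v ≡ true → Σ (Fin k) λ j → Q v j ≡ true) →
    count P ≤ ∑ (λ j → count (λ v → P v ∧ Q v j))
  union-bound P Q h = ≤-trans (∑-mono-≤ _ _ pointwise) (≤-reflexive (∑-comm (λ v j → toℕᵇ (P v ∧ Q v j))))
    where
    pointwise : ∀ v → toℕᵇ (P v) ≤ ∑ (λ j → toℕᵇ (P v ∧ Q v j))
    pointwise v with P v in e
    ... | false = z≤n
    ... | true  = let j , q = h v e in
                  ≤-trans (≤-reflexive (cong toℕᵇ (sym q))) (term≤∑ (toℕᵇ ∘ Q v) j)

  _≺_ : ∀ {n} → (Fin n → Bool) → (Fin n → Bool) → Set
  X ≺ Y = ∀ u v → X u ≡ true → Y v ≡ true → u <ᶠ v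

  -- The first q elements of R (all of R if it has fewer).
  initial : ∀ {n} → ℕ → (Fin n → Bool) → Fin n → Bool
  initial {suc n} zero    R i       = false
  initial {suc n} (suc q) R zero    = R zero
  initial {suc n} (suc q) R (suc i) = initial (if R zero then q else suc q) (R ∘ suc) i

  initial-⊆ : ∀ {n} q (R : Fin n → Bool) → initial q R ⊆ R
  initial-⊆ {suc n} zero    R i       ()
  initial-⊆ {suc n} (suc q) R zero    e = e
  initial-⊆ {suc n} (suc q) R (suc i) e = initial-⊆ _ (R ∘ suc) i e

  initial≡∧ : ∀ {n} q (R : Fin n → Bool) u → initial q R u ≡ R u ∧ initial q R u
  initial≡∧ q R u with initial q R u in e
  ... | false = sym (∧-zeroʳ (R u))
  ... | true  rewrite initial-⊆ q R u e = refl

  count-initial : ∀ {n} q (R : Fin n → Bool) → q ≤ count R → count (initial q R) ≡ q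
  count-initial {zero}  zero    R h = refl
  count-initial {suc n} zero    R h = count-none {suc n} _ (λ _ → refl)
  count-initial {suc n} (suc q) R h with R zero
  ... | true  = cong suc (count-initial q (R ∘ suc) (≤-pred h))
  ... | false = count-initial (suc q) (R ∘ suc) h

  rest : ∀ {n} → ℕ → (Fin n → Bool) → Fin n → Bool
  rest q R u = R u ∧ not (initial q R u)

  rest-⊆ : ∀ {n} q (R : Fin n → Bool) → rest q R ⊆ R
  rest-⊆ q R u e = proj₁ (∧-true e)

  rest-∉-initial : ∀ {n} q (R : Fin n → Bool) u → rest q R u ≡ true → initial q R u ≡ false
  rest-∉-initial q R u e with initial q R u | proj₂ (∧-true {R u} e)
  ... | false | _ = refl

  initial≺rest : ∀ {n} q (R : Fin n → Bool) → initial q R ≺ rest q R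
  initial≺rest q R u v iu rv = go q R u v iu (rest-⊆ q R v rv) (rest-∉-initial q R v rv)
    where
    go : ∀ {n} q (R : Fin n → Bool) u v → initial q R u ≡ true → R v ≡ true → initial q R v ≡ false → u <ᶠ v
    go {suc n} (suc q) R zero    zero    _  rv tv = ⊥-elim (not-¬ refl (trans (sym rv) tv))
    go {suc n} (suc q) R zero    (suc v) _  _  _  = s≤s z≤n
    go {suc n} (suc q) R (suc u) zero    _  rv tv = ⊥-elim (not-¬ refl (trans (sym rv) tv))
    go {suc n} (suc q) R (suc u) (suc v) tu rv tv = s≤s (go _ (R ∘ suc) u v tu rv tv)

  count-rest : ∀ {n} q (R : Fin n → Bool) → q ≤ count R → count R ≡ q + count (rest q R)
  count-rest q R h = begin
    count R                                   ≡⟨ count-split R (initial q R) ⟩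
    count (λ u → R u ∧ initial q R u) + _     ≡⟨ cong (_+ count (rest q R))
                                                   (sym (count-cong _ _ (initial≡∧ q R))) ⟩
    count (initial q R) + count (rest q R)    ≡⟨ cong (_+ count (rest q R)) (count-initial q R h) ⟩
    q + count (rest q R)                      ∎
    where open ≡-Reasoning

  blocks : ∀ {n} k → ℕ → (Fin n → Bool) → Fin k → Fin n → Bool
  blocks (suc k) Z R zero    = initial Z R
  blocks (suc k) Z R (suc i) = blocks k Z (rest Z R) i

  blocks-⊆ : ∀ {n} k Z (R : Fin n → Bool) i → blocks k Z R i ⊆ R
  blocks-⊆ (suc k) Z R zero    u e = initial-⊆ Z R u e
  blocks-⊆ (suc k) Z R (suc i) u e = rest-⊆ Z R u (blocks-⊆ k Z (rest Z R) i u e)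

  count-blocks : ∀ {n} k Z (R : Fin n → Bool) → k * Z ≤ count R → ∀ i → count (blocks k Z R i) ≡ Z
  count-blocks (suc k) Z R h zero    = count-initial Z R (≤-trans (m≤m+n Z _) h)
  count-blocks (suc k) Z R h (suc i) = count-blocks k Z (rest Z R) (+-cancelˡ-≤ Z _ _ h′) i
    where
    h′ : Z + k * Z ≤ Z + count (rest Z R)
    h′ = subst (Z + k * Z ≤_) (count-rest Z R (≤-trans (m≤m+n Z _) h)) h

  blocks-ordered : ∀ {n} k Z (R : Fin n → Bool) i j → i <ᶠ j → blocks k Z R i ≺ blocks k Z R j
  blocks-ordered (suc k) Z R zero (suc j) _ u v bu bv =
    initial≺rest Z R u v bu (blocks-⊆ k Z (rest Z R) j v bv)
  blocks-ordered (suc k) Z R (suc i) (suc j) (s≤s i<j) = blocks-ordered k Z (rest Z R) i j i<j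

  blocks-disjoint : ∀ {n} k Z (R : Fin n → Bool) u → ∑ (λ b → toℕᵇ (blocks k Z R b u)) ≤ toℕᵇ (R u)
  blocks-disjoint zero    Z R u = z≤n
  blocks-disjoint (suc k) Z R u = begin
    toℕᵇ (initial Z R u) + ∑ (λ b → toℕᵇ (blocks k Z (rest Z R) b u))
      ≤⟨ +-monoʳ-≤ (toℕᵇ (initial Z R u)) (blocks-disjoint k Z (rest Z R) u) ⟩
    toℕᵇ (initial Z R u) + toℕᵇ (rest Z R u)
      ≡⟨ cong (λ b → toℕᵇ b + toℕᵇ (rest Z R u)) (initial≡∧ Z R u) ⟩
    toℕᵇ (R u ∧ initial Z R u) + toℕᵇ (rest Z R u)
      ≡⟨ split (R u) (initial Z R u) ⟩
    toℕᵇ (R u) ∎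
    where
    open ≤-Reasoning
    split : ∀ a b → toℕᵇ (a ∧ b) + toℕᵇ (a ∧ not b) ≡ toℕᵇ a
    split false b     = refl
    split true  false = refl
    split true  true  = refl

  ∑∈ : ∀ {m} → (Fin m → Bool) → (Fin m → ℕ) → ℕ
  ∑∈ A f = ∑ (λ i → toℕᵇ (A i) * f i)

  ∑∈-*ˡ : ∀ {m} (A : Fin m → Bool) f c → ∑∈ A (λ i → c * f i) ≡ c * ∑∈ A f
  ∑∈-*ˡ {m} A f c = trans (∑-cong _ _ (λ i → swap (toℕᵇ (A i)) c (f i))) (∑-*ˡ {m} c _)
    where
    swap : ∀ a c x → a * (c * x) ≡ c * (a * x)
    swap = solve-∀

  ∑∈≤*count : ∀ {m} (A : Fin m → Bool) f C → (∀ i → A i ≡ true → f i ≤ C) → ∑∈ A f ≤ C * count A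
  ∑∈≤*count {m} A f C h = ≤-trans (∑-mono-≤ _ _ pointwise) (≤-reflexive (∑-*ˡ {m} C (toℕᵇ ∘ A)))
    where
    pointwise : ∀ i → toℕᵇ (A i) * f i ≤ C * toℕᵇ (A i)
    pointwise i with A i in e
    ... | false = z≤n
    ... | true  = ≤-trans (≤-reflexive (+-identityʳ (f i))) (≤-trans (h i e) (≤-reflexive (sym (*-identityʳ C))))

  markov∈ : ∀ {m} (P A : Fin m → Bool) f C → P ⊆ A → (∀ i → P i ≡ true → C ≤ f i) → C * count P ≤ ∑∈ A f
  markov∈ P A f C P⊆A h = markov P _ C (λ i e → subst (λ a → C ≤ toℕᵇ a * f i) (sym (P⊆A i e))
                                                   (≤-trans (h i e) (≤-reflexive (sym (+-identityʳ (f i))))))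

  ∑-count-disjoint : ∀ {n q} (block : Fin q → Fin n → Bool) (B : Fin n → Bool) →
    (∀ u → ∑ (λ b → toℕᵇ (block b u)) ≤ toℕᵇ (B u)) → ∀ (M : Fin n → Bool) →
    ∑ (λ b → count (λ u → block b u ∧ M u)) ≤ count (λ u → B u ∧ M u)
  ∑-count-disjoint {n} {q} block B disjoint M =
    ≤-trans (≤-reflexive (∑-comm {q} {n} (λ b u → toℕᵇ (block b u ∧ M u)))) (∑-mono-≤ _ _ pointwise)
    where
    pointwise : ∀ u → ∑ (λ b → toℕᵇ (block b u ∧ M u)) ≤ toℕᵇ (B u ∧ M u)
    pointwise u with M u
    ... | true  = subst₂ _≤_ (∑-cong _ _ (λ b → cong toℕᵇ (sym (∧-identityʳ (block b u)))))
                             (cong toℕᵇ (sym (∧-identityʳ (B u)))) (disjoint u)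
    ... | false = ≤-trans (≤-reflexive (∑-zero {q} _ (λ b → cong toℕᵇ (∧-zeroʳ (block b u))))) z≤n

  Disjoint : ∀ {n} → (Fin n → Bool) → (Fin n → Bool) → Set
  Disjoint X Y = ∀ u → X u ≡ true → Y u ≡ false

  ⋃ : ∀ {n} → List (Fin n → Bool) → Fin n → Bool
  ⋃ []      u = false
  ⋃ (X ∷ F) u = X u ∨ ⋃ F u

  count-⋃ : ∀ {n} (F : List (Fin n → Bool)) ℓ → AllPairs Disjoint F → All (λ X → count X ≡ ℓ) F →
    count (⋃ F) ≡ length F * ℓ
  count-⋃ {n} []      ℓ []                  []          = count-none {n} _ (λ _ → refl)
  count-⋃ {n} (X ∷ F) ℓ (X∩F=∅ ∷ disjoint) (|X| ∷ |F|) =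
    trans (∑-cong _ _ (λ u → toℕᵇ-∨ (X u) (⋃ F u) (∉⋃ X∩F=∅ u)))
          (trans (∑-distrib-+ {n} _ _) (cong₂ _+_ |X| (count-⋃ F ℓ disjoint |F|)))
    where
    toℕᵇ-∨ : ∀ a b → (a ≡ true → b ≡ false) → toℕᵇ (a ∨ b) ≡ toℕᵇ a + toℕᵇ b
    toℕᵇ-∨ true  b h rewrite h refl = refl
    toℕᵇ-∨ false b h = refl
    ∉⋃ : ∀ {Ys} → All (Disjoint X) Ys → ∀ u → X u ≡ true → ⋃ Ys u ≡ false
    ∉⋃ []                  u e = refl
    ∉⋃ (X∩Y=∅ ∷ X∩Ys=∅) u e rewrite X∩Y=∅ u e = ∉⋃ X∩Ys=∅ u e

  same : Bool → Bool → Bool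
  same true  b = b
  same false b = not b

  same-sound : ∀ s b → same s b ≡ true → s ≡ b
  same-sound true  true  _ = refl
  same-sound false false _ = refl

  tailGraph : ∀ {k} → OGraph (suc k) → OGraph k
  tailGraph H = record
    { adj    = λ i j → adj H (suc i) (suc j)
    ; sym    = λ i j → OGraph.sym H (suc i) (suc j)
    ; irrefl = λ i → irrefl H (suc i) }

  module Degrees {n} (G : OGraph n) where

    -- deg false also counts v itself when v ∈ B, since adj G v v is false.
    deg : Bool → Fin n → (Fin n → Bool) → ℕ
    deg s v B = count (λ u → B u ∧ same s (adj G v u))

    deg-mono : ∀ s v {B B′ : Fin n → Bool} → B ⊆ B′ → deg s v B ≤ deg s v B′
    deg-mono s v {B} {B′} B⊆B′ = count-mono _ _ restrict
      where
      restrict : ∀ u → (B u ∧ same s (adj G v u)) ≡ true → (B′ u ∧ same s (adj G v u)) ≡ true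
      restrict u e with ∧-true e
      ... | e₁ , e₂ rewrite B⊆B′ u e₁ | e₂ = refl

    deg≤count : ∀ s v B → deg s v B ≤ count B
    deg≤count s v B = count-mono _ B (λ u e → proj₁ (∧-true e))

    deg-∪ : ∀ s v X Y → deg s v (λ u → X u ∨ Y u) ≤ deg s v X + deg s v Y
    deg-∪ s v X Y = ≤-trans (∑-mono-≤ _ _ (λ u → pointwise (X u) (Y u) (same s (adj G v u))))
                            (≤-reflexive (∑-distrib-+ {n} _ _))
      where
      pointwise : ∀ x y a → toℕᵇ ((x ∨ y) ∧ a) ≤ toℕᵇ (x ∧ a) + toℕᵇ (y ∧ a)
      pointwise true  y true  = s≤s z≤n
      pointwise true  y false = z≤n
      pointwise false y a     = ≤-refl

    ∑∈-deg-comm : ∀ s A B → ∑∈ A (λ v → deg s v B) ≡ ∑∈ B (λ u → deg s u A)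
    ∑∈-deg-comm s A B = begin
        ∑ (λ v → toℕᵇ (A v) * deg s v B)
      ≡⟨ ∑-cong _ _ (λ v → toℕᵇ*count {n} (A v) _) ⟩
        ∑ (λ v → ∑ (λ u → toℕᵇ (A v ∧ (B u ∧ same s (adj G v u)))))
      ≡⟨ ∑-comm (λ v u → toℕᵇ (A v ∧ (B u ∧ same s (adj G v u)))) ⟩
        ∑ (λ u → ∑ (λ v → toℕᵇ (A v ∧ (B u ∧ same s (adj G v u)))))
      ≡⟨ ∑-cong _ _ (λ u → ∑-cong _ _ (λ v → cong toℕᵇ (swap (A v) (B u) (adj G v u) (adj G u v)
                                                           (OGraph.sym G v u)))) ⟩
        ∑ (λ u → ∑ (λ v → toℕᵇ (B u ∧ (A v ∧ same s (adj G u v)))))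
      ≡⟨ sym (∑-cong _ _ (λ u → toℕᵇ*count {n} (B u) _)) ⟩
        ∑ (λ u → toℕᵇ (B u) * deg s u A) ∎
      where
      open ≡-Reasoning
      swap : ∀ a b x y → x ≡ y → (a ∧ (b ∧ same s x)) ≡ (b ∧ (a ∧ same s y))
      swap true  true  x _ refl = refl
      swap true  false x _ refl = refl
      swap false true  x _ refl = refl
      swap false false x _ refl = refl

  -- Greedy embedding

  -- Each greedy step shrinks the candidate sets by a factor m, and the final pigeonhole over the
  -- remaining k sets costs a factor k.
  loss : ℕ → ℕ → ℕ → ℕ
  loss m k c = c * (m ^ k * k)

  loss-step : ∀ m k c → loss m k (c * m) ≤ loss m (suc k) c
  loss-step m k c = begin
      c * m * (m ^ k * k)   ≡⟨ *-assoc c m _ ⟩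
      c * (m * (m ^ k * k)) ≡⟨ cong (c *_) (sym (*-assoc m (m ^ k) k)) ⟩
      c * (m ^ suc k * k)   ≤⟨ *-monoʳ-≤ c (*-monoʳ-≤ (m ^ suc k) (n≤1+n k)) ⟩
      c * (m ^ suc k * suc k) ∎
    where open ≤-Reasoning

  loss-bound : ∀ m .{{_ : NonZero m}} k c x → x ≤ suc k → c * x ≤ loss m (suc k) c
  loss-bound m k c x x≤ = *-monoʳ-≤ c (≤-trans x≤ (m≤n*m (suc k) (m ^ suc k) {{m^n≢0 m (suc k)}}))

  loss≢0 : ∀ m .{{_ : NonZero m}} k → NonZero (loss m (suc k) 1)
  loss≢0 m k = >-nonZero (≤-trans (m^n>0 m (suc k)) (≤-trans (m≤m*n (m ^ suc k) (suc k)) (≤-reflexive (sym (*-identityˡ _)))))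

  module Embedding {n} (G : OGraph n) (m : ℕ) .{{_ : NonZero m}} (R : Fin n → Bool) where
    open Degrees G

    record SparsePair (Q T : ℕ) : Set where
      field
        s       : Bool
        A B     : Fin n → Bool
        A⊆R     : A ⊆ R
        B⊆R     : B ⊆ R
        A≺B     : A ≺ B
        A-large : T ≤ Q * count A
        B-large : T ≤ Q * count B
        sparse  : ∀ v → A v ≡ true → m * deg s v B < count B

    SparsePair-weaken : ∀ {Q Q′ T} → Q ≤ Q′ → SparsePair Q T → SparsePair Q′ T
    SparsePair-weaken Q≤Q′ p = record
      { s = s ; A = A ; B = B ; A⊆R = A⊆R ; B⊆R = B⊆R ; A≺B = A≺B ; sparse = sparse
      ; A-large = ≤-trans A-large (*-monoˡ-≤ (count A) Q≤Q′)
      ; B-large = ≤-trans B-large (*-monoˡ-≤ (count B) Q≤Q′) }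
      where open SparsePair p

    emptySparsePair : ∀ Q → SparsePair Q 0
    emptySparsePair Q = record
      { s = true ; A = λ _ → false ; B = λ _ → false ; A⊆R = λ _ () ; B⊆R = λ _ ()
      ; A≺B = λ _ _ () ; A-large = z≤n ; B-large = z≤n ; sparse = λ _ () }

    EmbedsIn : ∀ {k} → OGraph k → (Fin k → Fin n → Bool) → Set
    EmbedsIn {k} H W = Σ (Fin k → Fin n) λ f →
      (∀ i → W i (f i) ≡ true) × (∀ i j → adj H i j ≡ adj G (f i) (f j))

    firstRow : ∀ {k} → OGraph (suc k) → Fin k → Bool
    firstRow H j = adj H zero (suc j)

    Typical : ∀ {k} → OGraph (suc k) → (Fin (suc k) → Fin n → Bool) → Fin n → Fin k → Set
    Typical H W v j = count (W (suc j)) ≤ m * deg (firstRow H j) v (W (suc j))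

    typical? : ∀ {k} H W v j → Dec (Typical {k} H W v j)
    typical? H W v j = _ ≤? _

    candidatesAfter : ∀ {k} → OGraph (suc k) → (Fin (suc k) → Fin n → Bool) → Fin n → Fin k → Fin n → Bool
    candidatesAfter H W v j u = W (suc j) u ∧ same (firstRow H j) (adj G v u)

    candidatesAfter-large : ∀ {k} H W c T v → (∀ j → Typical {k} H W v j) → (∀ i → T ≤ c * count (W i)) →
      ∀ j → T ≤ c * m * count (candidatesAfter H W v j)
    candidatesAfter-large H W c T v typical W-large j = begin
      T                                        ≤⟨ W-large (suc j) ⟩
      c * count (W (suc j))                    ≤⟨ *-monoʳ-≤ c (typical j) ⟩
      c * (m * count (candidatesAfter H W v j)) ≡⟨ sym (*-assoc c m _) ⟩
      c * m * count (candidatesAfter H W v j)  ∎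
      where open ≤-Reasoning

    extend-embedding : ∀ {k} H W v → W zero v ≡ true →
      EmbedsIn (tailGraph H) (candidatesAfter {k} H W v) → EmbedsIn H W
    extend-embedding H W v v∈W₀ (f′ , f′∈ , f′-adj) = f , f∈ , f-adj
      where
      f : Fin _ → Fin n
      f zero    = v
      f (suc i) = f′ i
      f∈ : ∀ i → W i (f i) ≡ true
      f∈ zero    = v∈W₀
      f∈ (suc i) = proj₁ (∧-true (f′∈ i))
      row : ∀ j → adj H zero (suc j) ≡ adj G v (f′ j)
      row j = same-sound _ _ (proj₂ (∧-true (f′∈ j)))
      f-adj : ∀ i j → adj H i j ≡ adj G (f i) (f j)
      f-adj zero    zero    = trans (irrefl H zero) (sym (irrefl G v))
      f-adj zero    (suc j) = row j
      f-adj (suc i) zero    = trans (OGraph.sym H (suc i) zero) (trans (row i) (OGraph.sym G v (f′ i)))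
      f-adj (suc i) (suc j) = f′-adj i j

    -- If no vertex of W₀ is typical towards every later set, pigeonhole gives one later set that
    -- a 1/k fraction of W₀ is atypical towards.
    sparse-from-atypical : ∀ k H W c T → (∀ i → W i ⊆ R) → (∀ i j → i <ᶠ j → W i ≺ W j) →
      (∀ i → T ≤ c * count (W i)) → ¬ (Σ (Fin n) λ v → W zero v ≡ true × ∀ j → Typical {k} H W v j) →
      SparsePair (loss m (suc k) c) T
    sparse-from-atypical zero H W c T _ _ W-large none =
      subst (SparsePair _) (sym (n≤0⇒n≡0 T≤0)) (emptySparsePair _)
      where
      W₀-empty : ∀ v → W zero v ≡ false
      W₀-empty v with W zero v in e
      ... | false = refl
      ... | true  = ⊥-elim (none (v , e , λ ()))
      T≤0 : T ≤ 0
      T≤0 = subst (T ≤_) (trans (cong (c *_) (count-none (W zero) W₀-empty)) (*-zeroʳ c)) (W-large zero)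
    sparse-from-atypical (suc k) H W c T W⊆R W-ordered W-large none = record
      { s = firstRow H j ; A = A ; B = W (suc j)
      ; A⊆R = λ u e → W⊆R zero u (proj₁ (∧-true e))
      ; B⊆R = W⊆R (suc j)
      ; A≺B = λ u v e₁ e₂ → W-ordered zero (suc j) (s≤s z≤n) u v (proj₁ (∧-true e₁)) e₂
      ; A-large = A-large
      ; B-large = ≤-trans (W-large (suc j))
                   (≤-trans (≤-reflexive (cong (_* count (W (suc j))) (sym (*-identityʳ c))))
                     (*-monoˡ-≤ (count (W (suc j))) (loss-bound m (suc k) c 1 (s≤s z≤n))))
      ; sparse = λ v e → does-true (_ <? _) (proj₂ (∧-true e)) }
      where
      atypical : Fin n → Fin (suc k) → Bool
      atypical v j = does (m * deg (firstRow H j) v (W (suc j)) <? count (W (suc j)))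
      some-atypical : ∀ v → W zero v ≡ true → Σ (Fin (suc k)) λ j → atypical v j ≡ true
      some-atypical v e =
        let j , ¬typical = ¬∀⟶∃¬ (suc k) _ (typical? H W v) (λ all → none (v , e , all))
        in j , dec-true (_ <? _) (≰⇒> ¬typical)
      atypicalCount : Fin (suc k) → ℕ
      atypicalCount j = count (λ v → W zero v ∧ atypical v j)
      j : Fin (suc k)
      j = proj₁ (∃-above-average atypicalCount)
      A : Fin n → Bool
      A v = W zero v ∧ atypical v j
      A-large : T ≤ loss m (suc (suc k)) c * count A
      A-large = begin
        T                            ≤⟨ W-large zero ⟩
        c * count (W zero)           ≤⟨ *-monoʳ-≤ c (union-bound (W zero) atypical some-atypical) ⟩
        c * ∑ atypicalCount          ≤⟨ *-monoʳ-≤ c (proj₂ (∃-above-average atypicalCount)) ⟩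
        c * (suc k * count A)        ≡⟨ sym (*-assoc c (suc k) _) ⟩
        c * suc k * count A          ≤⟨ *-monoˡ-≤ (count A) (loss-bound m (suc k) c (suc k) (n≤1+n _)) ⟩
        loss m (suc (suc k)) c * count A ∎
        where open ≤-Reasoning

    -- Map vertex 0 to a vertex typical towards all later candidate sets and recurse.
    embed-or-sparse : ∀ k (H : OGraph k) (W : Fin k → Fin n → Bool) c T →
      (∀ i → W i ⊆ R) → (∀ i j → i <ᶠ j → W i ≺ W j) → (∀ i → T ≤ c * count (W i)) →
      EmbedsIn H W ⊎ SparsePair (loss m k c) T
    embed-or-sparse zero H W c T _ _ _ = inj₁ ((λ ()) , (λ ()) , (λ ()))
    embed-or-sparse (suc k) H W c T W⊆R W-ordered W-large
      with any? (λ v → (W zero v ≟ᵇ true) ×-dec all? (typical? H W v))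
    ... | no none = inj₂ (sparse-from-atypical k H W c T W⊆R W-ordered W-large none)
    ... | yes (v , v∈W₀ , typical)
      with embed-or-sparse k (tailGraph H) (candidatesAfter H W v) (c * m) T
             (λ i u e → W⊆R (suc i) u (proj₁ (∧-true e)))
             (λ i j i<j u w e₁ e₂ → W-ordered (suc i) (suc j) (s≤s i<j) u w (proj₁ (∧-true e₁)) (proj₁ (∧-true e₂)))
             (candidatesAfter-large H W c T v typical W-large)
    ...   | inj₁ embedding = inj₁ (extend-embedding H W v v∈W₀ embedding)
    ...   | inj₂ pair      = inj₂ (SparsePair-weaken (loss-step m k c) pair)

  -- Bisparse pairs

  quotient-bounds : ∀ x N .{{_ : NonZero N}} → x / N * N ≤ x × x < suc (x / N) * N
  quotient-bounds x N = m/n*n≤m x N , (begin-strict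
    x                 ≡⟨ m≡m%n+[m/n]*n x N ⟩
    x % N + x / N * N <⟨ +-monoˡ-< _ (m%n<n x N) ⟩
    N + x / N * N     ∎)
    where open ≤-Reasoning

  module Sparsification {n} (G : OGraph n) (m : ℕ) .{{_ : NonZero m}} where
    open Degrees G

    record SparseBlock (s : Bool) (A₀ B₀ : Fin n → Bool) (N : ℕ) : Set where
      field
        A B    : Fin n → Bool
        A⊆A₀   : A ⊆ A₀
        B⊆B₀   : B ⊆ B₀
        A-half : count A₀ ≤ 2 * count A
        B-size : count B ≡ N
        sparse : ∀ v → A v ≡ true → m * deg s v B < 4 * N

    -- Cut B₀ into q blocks of size N.  A vertex of A₀ is dense (m·deg ≥ 4N) towards at most
    -- (q+1)/4 of them, so some block has at most half of A₀ dense towards it.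
    sparse-block : ∀ s (A₀ B₀ : Fin n → Bool) N .{{_ : NonZero N}} → N ≤ count B₀ →
      (∀ v → A₀ v ≡ true → m * deg s v B₀ < count B₀) → SparseBlock s A₀ B₀ N
    sparse-block s A₀ B₀ N N≤B₀ sparse₀ with count B₀ / N | quotient-bounds (count B₀) N
    ... | zero  | _ , B₀<N = ⊥-elim (<⇒≱ (≤-trans B₀<N (≤-reflexive (+-identityʳ N))) N≤B₀)
    ... | suc q | qN≤B₀ , B₀<[q+2]N = record
      { A = A₁ ; B = block b* ; A⊆A₀ = λ u e → proj₁ (∧-true e)
      ; B⊆B₀ = blocks-⊆ (suc q) N B₀ b*
      ; A-half = A-half ; B-size = count-blocks (suc q) N B₀ qN≤B₀ b*
      ; sparse = λ v e → ≰⇒> (does-false (4 * N ≤? _) (not-true (proj₂ (∧-true e)))) }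
      where
      block : Fin (suc q) → Fin n → Bool
      block = blocks (suc q) N B₀
      dense : Fin n → Fin (suc q) → Bool
      dense v b = does (4 * N ≤? m * deg s v (block b))
      denseCount : Fin (suc q) → ℕ
      denseCount b = count (λ v → A₀ v ∧ dense v b)

      few-dense : ∀ v → A₀ v ≡ true → 2 * count (dense v) ≤ suc q
      few-dense v e = ≤-trans (*-monoˡ-≤ (count (dense v)) (s≤s (s≤s (z≤n {2})))) (≤-pred 4c<q+2)
        where
        4Nc<[q+2]N : 4 * count (dense v) * N < suc (suc q) * N
        4Nc<[q+2]N = begin-strict
          4 * count (dense v) * N             ≡⟨ swap (count (dense v)) N ⟩
          4 * N * count (dense v)             ≤⟨ markov (dense v) (λ b → m * deg s v (block b)) (4 * N)
                                                    (λ b → does-true (4 * N ≤? _)) ⟩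
          ∑ (λ b → m * deg s v (block b))     ≡⟨ ∑-*ˡ m (λ b → deg s v (block b)) ⟩
          m * ∑ (λ b → deg s v (block b))     ≤⟨ *-monoʳ-≤ m (∑-count-disjoint block B₀
                                                    (blocks-disjoint (suc q) N B₀) _) ⟩
          m * deg s v B₀                      <⟨ sparse₀ v e ⟩
          count B₀                            <⟨ B₀<[q+2]N ⟩
          suc (suc q) * N                     ∎
          where
          open ≤-Reasoning
          swap : ∀ x y → 4 * x * y ≡ 4 * y * x
          swap = solve-∀
        4c<q+2 : 4 * count (dense v) < suc (suc q)
        4c<q+2 = *-cancelʳ-< N _ _ 4Nc<[q+2]N

      2∑≤[q+1]A₀ : 2 * ∑ denseCount ≤ suc q * count A₀
      2∑≤[q+1]A₀ = begin
        2 * ∑ denseCount                                    ≡⟨ cong (2 *_) (∑-comm (λ b v → toℕᵇ (A₀ v ∧ dense v b))) ⟩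
        2 * ∑ (λ v → ∑ (λ b → toℕᵇ (A₀ v ∧ dense v b)))     ≡⟨ sym (∑-*ˡ {n} 2 _) ⟩
        ∑ (λ v → 2 * ∑ (λ b → toℕᵇ (A₀ v ∧ dense v b)))     ≤⟨ ∑-mono-≤ _ _ pointwise ⟩
        ∑ (λ v → suc q * toℕᵇ (A₀ v))                       ≡⟨ ∑-*ˡ {n} (suc q) _ ⟩
        suc q * count A₀                                    ∎
        where
        open ≤-Reasoning
        pointwise : ∀ v → 2 * ∑ (λ b → toℕᵇ (A₀ v ∧ dense v b)) ≤ suc q * toℕᵇ (A₀ v)
        pointwise v with A₀ v in e
        ... | false = ≤-trans (≤-reflexive (cong (2 *_) (∑-zero {suc q} _ (λ _ → refl)))) z≤n
        ... | true  = ≤-trans (few-dense v e) (≤-reflexive (sym (*-identityʳ _)))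

      b* : Fin (suc q)
      b* = proj₁ (∃-below-average denseCount)

      2dense≤A₀ : 2 * denseCount b* ≤ count A₀
      2dense≤A₀ = *-cancelˡ-≤ (suc q) (begin
        suc q * (2 * denseCount b*) ≡⟨ swap (suc q) (denseCount b*) ⟩
        2 * (suc q * denseCount b*) ≤⟨ *-monoʳ-≤ 2 (proj₂ (∃-below-average denseCount)) ⟩
        2 * ∑ denseCount            ≤⟨ 2∑≤[q+1]A₀ ⟩
        suc q * count A₀            ∎)
        where
        open ≤-Reasoning
        swap : ∀ x y → x * (2 * y) ≡ 2 * (x * y)
        swap = solve-∀

      A₁ : Fin n → Bool
      A₁ v = A₀ v ∧ not (dense v b*)

      A-half : count A₀ ≤ 2 * count A₁
      A-half = begin
        count A₀  ≡⟨ A₀≡d+a ⟩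
        d + a     ≤⟨ +-monoˡ-≤ a d≤a ⟩
        a + a     ≡⟨ cong (a +_) (sym (+-identityʳ a)) ⟩
        2 * a     ∎
        where
        open ≤-Reasoning
        d = denseCount b*
        a = count A₁
        A₀≡d+a : count A₀ ≡ d + a
        A₀≡d+a = count-split A₀ (λ v → dense v b*)
        d≤a : d ≤ a
        d≤a = +-cancelˡ-≤ d _ _ (begin
          d + d     ≡⟨ cong (d +_) (sym (+-identityʳ d)) ⟩
          2 * d     ≤⟨ 2dense≤A₀ ⟩
          count A₀  ≡⟨ A₀≡d+a ⟩
          d + a     ∎)

    heavy : Bool → (Fin n → Bool) → ℕ → Fin n → Bool
    heavy s A N u = does (16 * N ≤? m * deg s u A)

    -- Double counting the s-pairs between A and B.
    few-heavy : ∀ s A B N .{{_ : NonZero N}} → count A ≡ 2 * N →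
      (∀ v → A v ≡ true → m * deg s v B < 8 * N) → count (λ u → B u ∧ heavy s A N u) ≤ N
    few-heavy s A B N |A|≡2N sparse = *-cancelˡ-≤ (16 * N) {{m*n≢0 16 N}} (begin
      16 * N * count (λ u → B u ∧ heavy s A N u)
        ≤⟨ markov∈ _ B (λ u → m * deg s u A) (16 * N) (λ u e → proj₁ (∧-true e))
                   (λ u e → does-true (16 * N ≤? _) (proj₂ (∧-true e))) ⟩
      ∑∈ B (λ u → m * deg s u A)  ≡⟨ ∑∈-*ˡ B (λ u → deg s u A) m ⟩
      m * ∑∈ B (λ u → deg s u A)  ≡⟨ cong (m *_) (sym (∑∈-deg-comm s A B)) ⟩
      m * ∑∈ A (λ v → deg s v B)  ≡⟨ sym (∑∈-*ˡ A (λ v → deg s v B) m) ⟩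
      ∑∈ A (λ v → m * deg s v B)  ≤⟨ ∑∈≤*count A _ (8 * N) (λ v e → <⇒≤ (sparse v e)) ⟩
      8 * N * count A             ≡⟨ cong (8 * N *_) |A|≡2N ⟩
      8 * N * (2 * N)             ≡⟨ rearrange N ⟩
      16 * N * N                  ∎)
      where
      open ≤-Reasoning
      rearrange : ∀ N → 8 * N * (2 * N) ≡ 16 * N * N
      rearrange = solve-∀

    module _ (R : Fin n → Bool) where
      open Embedding G m R

      record BiSparsePair (N : ℕ) : Set where
        field
          s        : Bool
          A B      : Fin n → Bool
          A⊆R      : A ⊆ R
          B⊆R      : B ⊆ R
          disjoint : Disjoint A B
          A-size   : count A ≡ N
          B-size   : count B ≡ N
          sparseA  : ∀ v → A v ≡ true → m * deg s v B < 16 * N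
          sparseB  : ∀ u → B u ≡ true → m * deg s u A < 16 * N

      -- Shrink A to a half that is sparse towards a block B₁ of B, then drop the vertices of B₁ that are
      -- dense towards A; both survive with at least N vertices.
      bisparse-from-sparse : ∀ N .{{_ : NonZero N}} Q .{{_ : NonZero Q}} →
        SparsePair Q (Q * (4 * N)) → BiSparsePair N
      bisparse-from-sparse N Q p = record
        { s = s ; A = A₃ ; B = B₃
        ; A⊆R = λ u e → A⊆R u (A₃⊆A u e)
        ; B⊆R = λ u e → B⊆R u (B₃⊆B u e)
        ; disjoint = disjoint
        ; A-size = count-initial N A₂ (≤-trans (m≤m+n N _) (≤-reflexive (sym |A₂|≡2N)))
        ; B-size = count-initial N B₂ N≤|B₂|
        ; sparseA = λ v e → <-≤-trans (≤-<-trans (*-monoʳ-≤ m (deg-mono s v B₃⊆B₁)) (sparse₂ v (initial-⊆ N A₂ v e)))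
                                      (*-monoˡ-≤ N (m≤m+n 8 8))
        ; sparseB = λ u e → ≤-<-trans (*-monoʳ-≤ m (deg-mono s u (initial-⊆ N A₂))) (light u (initial-⊆ N B₂ u e))
        }
        where
        open SparsePair p
        instance
          2N≢0 : NonZero (2 * N)
          2N≢0 = m*n≢0 2 N
        4N≤|B| : 4 * N ≤ count B
        4N≤|B| = *-cancelˡ-≤ Q B-large
        sb = sparse-block s A B (2 * N) (≤-trans (*-monoˡ-≤ N (s≤s (s≤s (z≤n {2})))) 4N≤|B|) sparse
        open SparseBlock sb renaming (A to A₁; B to B₁; A⊆A₀ to A₁⊆A; B⊆B₀ to B₁⊆B; sparse to sparse₁)
        2N≤|A₁| : 2 * N ≤ count A₁
        2N≤|A₁| = *-cancelˡ-≤ 2 (begin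
          2 * (2 * N)   ≡⟨ sym (*-assoc 2 2 N) ⟩
          4 * N         ≤⟨ *-cancelˡ-≤ Q A-large ⟩
          count A       ≤⟨ A-half ⟩
          2 * count A₁  ∎)
          where open ≤-Reasoning
        A₂ = initial (2 * N) A₁
        |A₂|≡2N : count A₂ ≡ 2 * N
        |A₂|≡2N = count-initial (2 * N) A₁ 2N≤|A₁|
        sparse₂ : ∀ v → A₂ v ≡ true → m * deg s v B₁ < 8 * N
        sparse₂ v e = subst (m * deg s v B₁ <_) (sym (*-assoc 4 2 N)) (sparse₁ v (initial-⊆ (2 * N) A₁ v e))
        B₂ : Fin n → Bool
        B₂ u = B₁ u ∧ not (heavy s A₂ N u)
        N≤|B₂| : N ≤ count B₂
        N≤|B₂| = +-cancelˡ-≤ N _ _ (begin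
          N + N                                          ≡⟨ cong (N +_) (sym (+-identityʳ N)) ⟩
          2 * N                                          ≡⟨ sym B-size ⟩
          count B₁                                       ≡⟨ count-split B₁ (heavy s A₂ N) ⟩
          count (λ u → B₁ u ∧ heavy s A₂ N u) + count B₂ ≤⟨ +-monoˡ-≤ _ (few-heavy s A₂ B₁ N |A₂|≡2N sparse₂) ⟩
          N + count B₂                                   ∎)
          where open ≤-Reasoning
        light : ∀ u → B₂ u ≡ true → m * deg s u A₂ < 16 * N
        light u e = ≰⇒> (does-false (16 * N ≤? _) (not-true (proj₂ (∧-true e))))
        A₃ = initial N A₂
        B₃ = initial N B₂
        A₃⊆A : A₃ ⊆ A
        A₃⊆A u e = A₁⊆A u (initial-⊆ (2 * N) A₁ u (initial-⊆ N A₂ u e))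
        B₃⊆B₁ : B₃ ⊆ B₁
        B₃⊆B₁ u e = proj₁ (∧-true (initial-⊆ N B₂ u e))
        B₃⊆B : B₃ ⊆ B
        B₃⊆B u e = B₁⊆B u (B₃⊆B₁ u e)
        disjoint : Disjoint A₃ B₃
        disjoint u e with B₃ u in e′
        ... | false = refl
        ... | true  = ⊥-elim (<-irrefl refl (A≺B u u (A₃⊆A u e) (B₃⊆B u e′)))

      bisparse-pair : ∀ {k} (H : OGraph (suc k)) → ¬ Contains G H → ∀ N .{{_ : NonZero N}} →
        suc k * (loss m (suc k) 1 * (4 * N)) ≤ count R → BiSparsePair N
      bisparse-pair {k} H H⊄G N R-large
        with embed-or-sparse (suc k) H W 1 Z (blocks-⊆ (suc k) Z R) (blocks-ordered (suc k) Z R) W-large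
        where
        Z = loss m (suc k) 1 * (4 * N)
        W = blocks (suc k) Z R
        W-large : ∀ i → Z ≤ 1 * count (W i)
        W-large i = ≤-reflexive (sym (trans (*-identityˡ _) (count-blocks (suc k) Z R R-large i)))
      ... | inj₁ (f , f∈ , f-adj) =
        ⊥-elim (H⊄G (f , (λ i j i<j → blocks-ordered (suc k) _ R i j i<j (f i) (f j) (f∈ i) (f∈ j)) , f-adj))
      ... | inj₂ pair = bisparse-from-sparse N (loss m (suc k) 1) {{loss≢0 m k}} pair

  -- The tree of bisparse pairs

  merge : ∀ {A : Set} → Bool → (Bool → List A) → (Bool → List A) → Bool → List A
  merge true  xs ys true  = xs true ++ ys true
  merge true  xs ys false = xs false
  merge false xs ys true  = xs true
  merge false xs ys false = xs false ++ ys false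

  All-merge : ∀ {A : Set} {P : A → Set} s {xs ys : Bool → List A} →
    (∀ b → All P (xs b)) → (∀ b → All P (ys b)) → ∀ b → All P (merge s xs ys b)
  All-merge true  px py true  = Allₚ.++⁺ (px true) (py true)
  All-merge true  px py false = px false
  All-merge false px py true  = px true
  All-merge false px py false = Allₚ.++⁺ (px false) (py false)

  AllPairs-merge : ∀ {A : Set} {R : Bool → A → A → Set} s {xs ys : Bool → List A} →
    (∀ b → AllPairs (R b) (xs b)) → (∀ b → AllPairs (R b) (ys b)) → All (λ x → All (R s x) (ys s)) (xs s) →
    ∀ b → AllPairs (R b) (merge s xs ys b)
  AllPairs-merge true  px py pxy true  = AllPairsₚ.++⁺ (px true) (py true) pxy
  AllPairs-merge true  px py pxy false = px false
  AllPairs-merge false px py pxy true  = px true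
  AllPairs-merge false px py pxy false = AllPairsₚ.++⁺ (px false) (py false) pxy

  merge-nonempty : ∀ {A : Set} s {xs ys : Bool → List A} → (∀ b → 1 ≤ length (xs b)) → ∀ b → 1 ≤ length (merge s xs ys b)
  merge-nonempty true  {xs} ne true  = ≤-trans (ne true) (≤-trans (m≤m+n _ _) (≤-reflexive (sym (length-++ (xs true)))))
  merge-nonempty true       ne false = ne false
  merge-nonempty false      ne true  = ne true
  merge-nonempty false {xs} ne false = ≤-trans (ne false) (≤-trans (m≤m+n _ _) (≤-reflexive (sym (length-++ (xs false)))))

  length-merge : ∀ {A : Set} s (xs ys : Bool → List A) →
    length (merge s xs ys true) + length (merge s xs ys false) ≡ length (xs true) + length (xs false) + length (ys s)
  length-merge true xs ys = begin
    length (xs true ++ ys true) + length (xs false)              ≡⟨ cong (_+ length (xs false)) (length-++ (xs true)) ⟩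
    length (xs true) + length (ys true) + length (xs false)     ≡⟨ swap (length (xs true)) _ _ ⟩
    length (xs true) + length (xs false) + length (ys true)     ∎
    where
    open ≡-Reasoning
    swap : ∀ a b c → a + b + c ≡ a + c + b
    swap = solve-∀
  length-merge false xs ys = begin
    length (xs true) + length (xs false ++ ys false)            ≡⟨ cong (length (xs true) +_) (length-++ (xs false)) ⟩
    length (xs true) + (length (xs false) + length (ys false))  ≡⟨ sym (+-assoc (length (xs true)) _ _) ⟩
    length (xs true) + length (xs false) + length (ys false)    ∎
    where open ≡-Reasoning

  length-merge-grows : ∀ {A : Set} s (xs ys : Bool → List A) h → h + 2 ≤ length (xs true) + length (xs false) →
    1 ≤ length (ys s) → suc h + 2 ≤ length (merge s xs ys true) + length (merge s xs ys false)
  length-merge-grows s xs ys h many nonempty = begin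
    suc (h + 2)                                                ≤⟨ s≤s many ⟩
    suc (length (xs true) + length (xs false))                 ≡⟨ +-comm 1 _ ⟩
    length (xs true) + length (xs false) + 1                   ≤⟨ +-monoʳ-≤ _ nonempty ⟩
    length (xs true) + length (xs false) + length (ys s)       ≡⟨ sym (length-merge s xs ys) ⟩
    length (merge s xs ys true) + length (merge s xs ys false) ∎
    where open ≤-Reasoning

  scale : ℕ → ℕ → ℕ → ℕ
  scale k K zero    = 1
  scale k K (suc h) = scale k K h * (suc k * (loss (16 * K * scale k K h) (suc k) 1 * 4))

  scale≢0 : ∀ k K .{{_ : NonZero K}} h → NonZero (scale k K h)
  scale≢0 k K zero    = _
  scale≢0 k K (suc h) = m*n≢0 P (suc k * (loss m (suc k) 1 * 4))
    where
    P = scale k K h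
    m = 16 * K * P
    instance
      P≢0 : NonZero P
      P≢0 = scale≢0 k K h
      16K≢0 : NonZero (16 * K)
      16K≢0 = m*n≢0 16 K
      m≢0 : NonZero m
      m≢0 = m*n≢0 (16 * K) P
      loss≢0′ : NonZero (loss m (suc k) 1)
      loss≢0′ = loss≢0 m k
      loss*4≢0 : NonZero (loss m (suc k) 1 * 4)
      loss*4≢0 = m*n≢0 (loss m (suc k) 1) 4
      factor≢0 : NonZero (suc k * (loss m (suc k) 1 * 4))
      factor≢0 = m*n≢0 (suc k) (loss m (suc k) 1 * 4)

  module Tree {n} (G : OGraph n) {k} (H : OGraph (suc k)) (H⊄G : ¬ Contains G H)
              (K ℓ : ℕ) .{{_ : NonZero K}} .{{_ : NonZero ℓ}} where
    open Degrees G

    Sparse : Bool → (Fin n → Bool) → (Fin n → Bool) → Set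
    Sparse s X Y = ∀ v → X v ≡ true → K * deg s v Y < ℓ

    Separated : Bool → (Fin n → Bool) → (Fin n → Bool) → Set
    Separated s X Y = Disjoint X Y × Sparse s X Y × Sparse s Y X

    Separated-⊆ : ∀ s {A B X Y} → Separated s A B → X ⊆ A → Y ⊆ B → Separated s X Y
    Separated-⊆ s {A} {B} {X} {Y} (disjoint , sparseAB , sparseBA) X⊆A Y⊆B = X∩Y=∅ , sparseXY , sparseYX
      where
      X∩Y=∅ : Disjoint X Y
      X∩Y=∅ u e with Y u in e′
      ... | false = refl
      ... | true  = ⊥-elim (not-¬ refl (trans (sym (Y⊆B u e′)) (disjoint u (X⊆A u e))))
      sparseXY : Sparse s X Y
      sparseXY v e = ≤-<-trans (*-monoʳ-≤ K (deg-mono s v Y⊆B)) (sparseAB v (X⊆A v e))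
      sparseYX : Sparse s Y X
      sparseYX u e = ≤-<-trans (*-monoʳ-≤ K (deg-mono s u X⊆A)) (sparseBA u (Y⊆B u e))

    record LeafFamilies (R : Fin n → Bool) (h : ℕ) : Set where
      field
        leaves    : Bool → List (Fin n → Bool)
        leaves⊆R  : ∀ b → All (_⊆ R) (leaves b)
        leaf-size : ∀ b → All (λ X → count X ≡ ℓ) (leaves b)
        separated : ∀ b → AllPairs (Separated b) (leaves b)
        nonempty  : ∀ b → 1 ≤ length (leaves b)
        many      : h + 2 ≤ length (leaves true) + length (leaves false)

    -- With m = 16 K P and N = ℓ P, the bound m·deg < 16 N of a bisparse pair is K·deg < ℓ.
    sparse-rescale : ∀ P d → 16 * K * P * d < 16 * (ℓ * P) → K * d < ℓ
    sparse-rescale P d lt = *-cancelʳ-< (16 * P) (K * d) ℓ (subst₂ _<_ (lhs K P d) (rhs ℓ P) lt)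
      where
      lhs : ∀ K P d → 16 * K * P * d ≡ K * d * (16 * P)
      lhs = solve-∀
      rhs : ∀ ℓ P → 16 * (ℓ * P) ≡ ℓ * (16 * P)
      rhs = solve-∀

    scale-unfold : ∀ h →
      suc k * (loss (16 * K * scale k K h) (suc k) 1 * (4 * (ℓ * scale k K h))) ≡ ℓ * scale k K (suc h)
    scale-unfold h = rearrange (suc k) (loss (16 * K * scale k K h) (suc k) 1) ℓ (scale k K h)
      where
      rearrange : ∀ a b c d → a * (b * (4 * (c * d))) ≡ c * (d * (a * (b * 4)))
      rearrange = solve-∀

    join : ∀ {R A B h} s → A ⊆ R → B ⊆ R → Separated s A B →
      LeafFamilies A h → LeafFamilies B h → LeafFamilies R (suc h)
    join {R} {A} {B} {h} s A⊆R B⊆R AB-separated TA TB = record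
      { leaves = merge s (LeafFamilies.leaves TA) (LeafFamilies.leaves TB)
      ; leaves⊆R = All-merge s (λ b → All.map (λ X⊆A u e → A⊆R u (X⊆A u e)) (LeafFamilies.leaves⊆R TA b))
                               (λ b → All.map (λ X⊆B u e → B⊆R u (X⊆B u e)) (LeafFamilies.leaves⊆R TB b))
      ; leaf-size = All-merge s (LeafFamilies.leaf-size TA) (LeafFamilies.leaf-size TB)
      ; separated = AllPairs-merge s (LeafFamilies.separated TA) (LeafFamilies.separated TB)
                      (All.map (λ X⊆A → All.map (λ Y⊆B → Separated-⊆ s AB-separated X⊆A Y⊆B)
                                                 (LeafFamilies.leaves⊆R TB s))
                               (LeafFamilies.leaves⊆R TA s))
      ; nonempty = merge-nonempty s (LeafFamilies.nonempty TA)
      ; many = length-merge-grows s (LeafFamilies.leaves TA) (LeafFamilies.leaves TB) h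
                 (LeafFamilies.many TA) (LeafFamilies.nonempty TB s)
      }

    -- Split R into a bisparse pair (A, B) of label s, recurse into both halves, and join the
    -- s-families of the two halves: every leaf below A is separated from every leaf below B.
    leafFamilies : ∀ h R → ℓ * scale k K h ≤ count R → LeafFamilies R h
    leafFamilies zero R R-large = record
      { leaves = λ _ → X ∷ []
      ; leaves⊆R = λ _ → initial-⊆ ℓ R ∷ []
      ; leaf-size = λ _ → count-initial ℓ R (≤-trans (≤-reflexive (sym (*-identityʳ ℓ))) R-large) ∷ []
      ; separated = λ _ → [] ∷ []
      ; nonempty = λ _ → ≤-refl
      ; many = ≤-refl }
      where X = initial ℓ R
    leafFamilies (suc h) R R-large =
      join s A⊆R B⊆R AB-separated (leafFamilies h A (≤-reflexive (sym A-size))) (leafFamilies h B (≤-reflexive (sym B-size)))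
      where
      P = scale k K h
      instance
        P≢0 : NonZero P
        P≢0 = scale≢0 k K h
        m≢0 : NonZero (16 * K * P)
        m≢0 = m*n≢0 (16 * K) P {{m*n≢0 16 K}}
        N≢0 : NonZero (ℓ * P)
        N≢0 = m*n≢0 ℓ P
      R-large′ : suc k * (loss (16 * K * P) (suc k) 1 * (4 * (ℓ * P))) ≤ count R
      R-large′ = subst (_≤ count R) (sym (scale-unfold h)) R-large
      open Sparsification.BiSparsePair (Sparsification.bisparse-pair G (16 * K * P) R H H⊄G (ℓ * P) R-large′)
      AB-separated : Separated s A B
      AB-separated = disjoint , (λ v e → sparse-rescale P _ (sparseA v e)) , (λ u e → sparse-rescale P _ (sparseB u e))

    sparse-to-⋃ : ∀ s X F → All (Sparse s X) F → ∀ v → X v ≡ true → K * deg s v (⋃ F) ≤ length F * ℓ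
    sparse-to-⋃ s X []      []          v e = ≤-reflexive (trans (cong (K *_) (count-none {n} _ (λ _ → refl))) (*-zeroʳ K))
    sparse-to-⋃ s X (Y ∷ F) (X→Y ∷ X→F) v e = begin
      K * deg s v (⋃ (Y ∷ F))               ≤⟨ *-monoʳ-≤ K (deg-∪ s v Y (⋃ F)) ⟩
      K * (deg s v Y + deg s v (⋃ F))       ≡⟨ *-distribˡ-+ K (deg s v Y) _ ⟩
      K * deg s v Y + K * deg s v (⋃ F)     ≤⟨ +-mono-≤ (<⇒≤ (X→Y v e)) (sparse-to-⋃ s X F X→F v e) ⟩
      ℓ + length F * ℓ                      ∎
      where open ≤-Reasoning

    sparse-from-⋃ : ∀ s X F → All (λ Y → Sparse s Y X) F → ∀ v → ⋃ F v ≡ true → K * deg s v X < ℓ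
    sparse-from-⋃ s X (Y ∷ F) (Y→X ∷ F→X) v e with Y v in e′
    ... | true  = Y→X v e′
    ... | false = sparse-from-⋃ s X F F→X v e

    -- A vertex of the union sees at most its own leaf fully and every other leaf sparsely.
    deg-⋃ : ∀ s F → AllPairs (Separated s) F → All (λ X → count X ≡ ℓ) F → ∀ v → ⋃ F v ≡ true →
      K * deg s v (⋃ F) ≤ K * ℓ + length F * ℓ
    deg-⋃ s (X ∷ F) (X-F ∷ separated) (|X| ∷ |F|) v e with X v in e′
    ... | true = begin
      K * deg s v (⋃ (X ∷ F))               ≤⟨ *-monoʳ-≤ K (deg-∪ s v X (⋃ F)) ⟩
      K * (deg s v X + deg s v (⋃ F))       ≡⟨ *-distribˡ-+ K (deg s v X) _ ⟩
      K * deg s v X + K * deg s v (⋃ F)     ≤⟨ +-mono-≤ (*-monoʳ-≤ K (≤-trans (deg≤count s v X) (≤-reflexive |X|)))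
                                                       (sparse-to-⋃ s X F (All.map (proj₁ ∘ proj₂) X-F) v e′) ⟩
      K * ℓ + length F * ℓ                  ≤⟨ +-monoʳ-≤ (K * ℓ) (m≤n+m _ ℓ) ⟩
      K * ℓ + (ℓ + length F * ℓ)            ∎
      where open ≤-Reasoning
    ... | false = begin
      K * deg s v (⋃ (X ∷ F))               ≤⟨ *-monoʳ-≤ K (deg-∪ s v X (⋃ F)) ⟩
      K * (deg s v X + deg s v (⋃ F))       ≡⟨ *-distribˡ-+ K (deg s v X) _ ⟩
      K * deg s v X + K * deg s v (⋃ F)     ≤⟨ +-mono-≤ (<⇒≤ (sparse-from-⋃ s X F (All.map (proj₂ ∘ proj₂) X-F) v e))
                                                       (deg-⋃ s F separated |F| v e) ⟩
      ℓ + (K * ℓ + length F * ℓ)            ≡⟨ swap ℓ (K * ℓ) _ ⟩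
      K * ℓ + (ℓ + length F * ℓ)            ∎
      where
      open ≤-Reasoning
      swap : ∀ a b c → a + (b + c) ≡ b + (a + c)
      swap = solve-∀

  LowDegree : ∀ {n} → OGraph n → ℕ → (Fin n → Bool) → Set
  LowDegree G E X = ∀ v → X v ≡ true → E * count (λ u → X u ∧ adj G v u) < count X

  module _ {n} (G : OGraph n) where
    open Degrees G

    LowDegree-of-label : ∀ s E X → (∀ v → X v ≡ true → E * deg s v X < count X) →
      LowDegree G E X ⊎ LowDegree (complement G) E X
    LowDegree-of-label true  E X low = inj₁ low
    LowDegree-of-label false E X low =
      inj₂ (λ v e → ≤-<-trans (*-monoʳ-≤ E (count-mono _ _ (complement⊆ v))) (low v e))
      where
      complement-adj : ∀ v u → adj (complement G) v u ≡ true → not (adj G v u) ≡ true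
      complement-adj v u e with v ≟ᶠ u
      ... | no _ = e
      complement⊆ : ∀ v u → (X u ∧ adj (complement G) v u) ≡ true → (X u ∧ not (adj G v u)) ≡ true
      complement⊆ v u e with X u
      ... | true = complement-adj v u e

    singleton-LowDegree : ∀ E (w : Fin n) → LowDegree G E (λ u → does (u ≟ᶠ w)) × count (λ u → does (u ≟ᶠ w)) ≡ 1
    singleton-LowDegree E w = low , count-singleton w
      where
      count-singleton : ∀ {n} (w : Fin n) → count (λ u → does (u ≟ᶠ w)) ≡ 1
      count-singleton {suc n} zero    = cong suc (count-none {n} _ (λ _ → refl))
      count-singleton {suc n} (suc w) = count-singleton {n} w
      no-neighbour : ∀ v → does (v ≟ᶠ w) ≡ true → ∀ u → (does (u ≟ᶠ w) ∧ adj G v u) ≡ false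
      no-neighbour v v≡w u with u ≟ᶠ w | v ≟ᶠ w
      ... | no _     | _ = refl
      ... | yes refl | yes refl = irrefl G u
      low : LowDegree G E (λ u → does (u ≟ᶠ w))
      low v e = subst₂ _<_ (sym (trans (cong (E *_) (count-none _ (no-neighbour v e))) (*-zeroʳ E)))
                           (sym (count-singleton w)) (s≤s z≤n)

  two-values-pigeonhole : ∀ K (f : Bool → ℕ) → K + K + 2 ≤ f true + f false → Σ Bool λ b → suc K ≤ f b
  two-values-pigeonhole K f h with suc K ≤? f true
  ... | yes K<f = true , K<f
  ... | no  K≮f = false , +-cancelˡ-≤ K _ _ (begin
    K + suc K               ≤⟨ m≤n+m _ 1 ⟩
    suc (K + suc K)         ≡⟨ rearrange K ⟩
    K + K + 2               ≤⟨ h ⟩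
    f true + f false        ≤⟨ +-monoˡ-≤ (f false) (≤-pred (≰⇒> K≮f)) ⟩
    K + f false             ∎)
    where
    open ≤-Reasoning
    rearrange : ∀ K → suc (K + suc K) ≡ K + K + 2
    rearrange = solve-∀

  low-degree-arithmetic : ∀ E K f ℓ d .{{_ : NonZero ℓ}} → 2 * E ≤ K → K < f → K * d ≤ K * ℓ + f * ℓ → E * d < f * ℓ
  low-degree-arithmetic E K f ℓ d 2E≤K K<f Kd≤ = *-cancelˡ-< 2 (E * d) (f * ℓ) (begin-strict
    2 * (E * d)       ≡⟨ sym (*-assoc 2 E d) ⟩
    2 * E * d         ≤⟨ *-monoˡ-≤ d 2E≤K ⟩
    K * d             ≤⟨ Kd≤ ⟩
    K * ℓ + f * ℓ     <⟨ +-monoˡ-< (f * ℓ) (*-monoˡ-< ℓ K<f) ⟩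
    f * ℓ + f * ℓ     ≡⟨ cong (f * ℓ +_) (sym (+-identityʳ (f * ℓ))) ⟩
    2 * (f * ℓ)       ∎)
    where open ≤-Reasoning

  module _ {n} (G : OGraph n) {k} (H : OGraph (suc k)) (H⊄G : ¬ Contains G H)
           (K ℓ : ℕ) .{{_ : NonZero K}} .{{_ : NonZero ℓ}} where
    open Degrees G
    open Tree G H H⊄G K ℓ

    -- One label owns f > K pairwise separated leaves; in their union X a vertex has at most
    -- ℓ + fℓ/K neighbours of that label, fewer than 2|X|/K.
    homogeneous-union : ∀ E R → 2 * E ≤ K → LeafFamilies R (K + K) →
      Σ (Fin n → Bool) λ X → ℓ ≤ count X × (LowDegree G E X ⊎ LowDegree (complement G) E X)
    homogeneous-union E R 2E≤K T = X , ℓ≤|X| , LowDegree-of-label G b E X low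
      where
      open LeafFamilies T
      b = proj₁ (two-values-pigeonhole K (length ∘ leaves) many)
      K<f = proj₂ (two-values-pigeonhole K (length ∘ leaves) many)
      X = ⋃ (leaves b)
      |X| : count X ≡ length (leaves b) * ℓ
      |X| = count-⋃ (leaves b) ℓ (AllPairs.map proj₁ (separated b)) (leaf-size b)
      ℓ≤|X| : ℓ ≤ count X
      ℓ≤|X| = ≤-trans (m≤n*m ℓ (length (leaves b)) {{>-nonZero (≤-trans (s≤s z≤n) K<f)}}) (≤-reflexive (sym |X|))
      low : ∀ v → X v ≡ true → E * deg b v X < count X
      low v e = subst (E * deg b v X <_) (sym |X|)
        (low-degree-arithmetic E K _ ℓ _ 2E≤K K<f (deg-⋃ b (leaves b) (separated b) (leaf-size b) v e))

  HomogeneousSet : ∀ {n} → OGraph n → ℕ → ℕ → Set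
  HomogeneousSet {n} G E D =
    Σ (Fin n → Bool) λ X → n ≤ D * count X × (LowDegree G E X ⊎ LowDegree (complement G) E X)

  small-HomogeneousSet : ∀ {n} (G : OGraph n) E D → n ≤ D → HomogeneousSet G E D
  small-HomogeneousSet {zero}  G E D _   = (λ _ → false) , z≤n , inj₁ (λ v ())
  small-HomogeneousSet {suc n} G E D n≤D = let low , |X|≡1 = singleton-LowDegree G E zero in
    _ , ≤-trans n≤D (≤-reflexive (sym (trans (cong (D *_) |X|≡1) (*-identityʳ D)))) , inj₁ low

  threshold : ℕ → ℕ → ℕ
  threshold k E = scale k (2 * E) (2 * E + 2 * E)

  -- If ⌊n / P⌋ = 0 a single vertex works.  Otherwise leaves of size ℓ = ⌊n / P⌋ fit below depth 2K,
  -- and ℓ ≤ |X| gives n < (ℓ + 1) P ≤ 2 P |X|.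
  large-HomogeneousSet : ∀ {k} (H : OGraph (suc k)) E .{{_ : NonZero E}} {n} (G : OGraph n) → ¬ Contains G H →
    HomogeneousSet G E (2 * threshold k E)
  large-HomogeneousSet {k} H E {n} G H⊄G = from-quotient (n / P) (quotient-bounds n P)
    where
    P = threshold k E
    K = 2 * E
    instance
      K≢0 : NonZero K
      K≢0 = m*n≢0 2 E
      P≢0 : NonZero P
      P≢0 = scale≢0 k K (K + K)
    from-quotient : ∀ q → q * P ≤ n × n < suc q * P → HomogeneousSet G E (2 * P)
    from-quotient zero (_ , n<P) =
      small-HomogeneousSet G E (2 * P) (≤-trans (<⇒≤ n<P) (≤-trans (≤-reflexive (+-identityʳ P)) (m≤n*m P 2)))
    from-quotient (suc ℓ) (ℓP≤n , n<[ℓ+2]P) = X , n≤2P|X| , low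
      where
      leaves = Tree.leafFamilies G H H⊄G K (suc ℓ) (K + K) (λ _ → true) (subst (suc ℓ * P ≤_) (sym count-all) ℓP≤n)
      result = homogeneous-union G H H⊄G K (suc ℓ) E (λ _ → true) ≤-refl leaves
      X = proj₁ result
      low = proj₂ (proj₂ result)
      n≤2P|X| : n ≤ 2 * P * count X
      n≤2P|X| = begin
        n                      ≤⟨ <⇒≤ n<[ℓ+2]P ⟩
        suc (suc ℓ) * P        ≤⟨ *-monoˡ-≤ P (s≤s (m≤n+m (suc ℓ) ℓ)) ⟩
        (suc ℓ + suc ℓ) * P    ≡⟨ rearrange (suc ℓ) P ⟩
        2 * P * suc ℓ          ≤⟨ *-monoʳ-≤ (2 * P) (proj₁ (proj₂ result)) ⟩
        2 * P * count X        ∎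
        where
        open ≤-Reasoning
        rearrange : ∀ a b → (a + a) * b ≡ 2 * b * a
        rearrange = solve-∀

  threshold≢0 : ∀ k E .{{_ : NonZero E}} → NonZero (threshold k E)
  threshold≢0 k E = scale≢0 k (2 * E) {{m*n≢0 2 E}} (2 * E + 2 * E)

  coprime-1 : ∀ x → Coprime x 1
  coprime-1 x = Coprime-sym (1-coprimeTo x)

  ℕtoℚ≡mkℚ : ∀ x → ℕtoℚ x ≡ mkℚ (ℤ.+ x) 0 (coprime-1 x)
  ℕtoℚ≡mkℚ x = ↥p/↧p≡p _

  ε-bound : ∀ ε → Positive ε → Σ ℕ λ E → ∀ d x → suc E * d < x → ℕtoℚ d <ℚ ε *ℚ ℕtoℚ x
  ε-bound (mkℚ (ℤ.+ suc p) q c) _ = q , λ d x h →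
    subst₂ (λ a b → a <ℚ mkℚ (ℤ.+ suc p) q c *ℚ b) (sym (ℕtoℚ≡mkℚ d)) (sym (ℕtoℚ≡mkℚ x))
      (toℚᵘ-cancel-< (ℚᵘ.<-respʳ-≃ (ℚᵘ.≃-sym (toℚᵘ-homo-* (mkℚ (ℤ.+ suc p) q c) (mkℚ (ℤ.+ x) 0 (coprime-1 x))))
        (ℚᵘ.*<* (subst₂ ℤ._<_ (ℤ.pos-* d (suc q * 1))
                              (trans (ℤ.pos-* (suc p * x) 1) (cong (ℤ._* ℤ.+ 1) (ℤ.pos-* (suc p) x)))
                              (ℤ.+<+ (cross-multiplied d x h))))))
    where
    -- ε ≥ 1/(q+1), and the claim d < εx is compared as d·(q+1) < (p+1)·x.
    cross-multiplied : ∀ d x → suc q * d < x → d * (suc q * 1) < suc p * x * 1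
    cross-multiplied d x h = begin-strict
      d * (suc q * 1)  ≡⟨ trans (cong (d *_) (*-identityʳ (suc q))) (*-comm d (suc q)) ⟩
      suc q * d        <⟨ h ⟩
      x                ≤⟨ m≤n*m x (suc p) ⟩
      suc p * x        ≡⟨ sym (*-identityʳ _) ⟩
      suc p * x * 1    ∎
      where open ≤-Reasoning
  ε-bound (mkℚ (ℤ.+ zero)  q c) ()
  ε-bound (mkℚ ℤ.-[1+ p ] q c) ()

  inverseℕ : (D : ℕ) → .{{NonZero D}} → ℚ
  inverseℕ (suc d) = mkℚ (ℤ.+ 1) d (1-coprimeTo (suc d))

  inverseℕ-positive : ∀ D .{{_ : NonZero D}} → Positive (inverseℕ D)
  inverseℕ-positive (suc d) = _

  inverseℕ-bound : ∀ D .{{_ : NonZero D}} n c → n ≤ D * c → inverseℕ D *ℚ ℕtoℚ n ≤ℚ ℕtoℚ c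
  inverseℕ-bound (suc d) n c h =
    subst₂ (λ a b → inverseℕ (suc d) *ℚ a ≤ℚ b) (sym (ℕtoℚ≡mkℚ n)) (sym (ℕtoℚ≡mkℚ c))
      (toℚᵘ-cancel-≤ (ℚᵘ.≤-respˡ-≃ (ℚᵘ.≃-sym (toℚᵘ-homo-* (inverseℕ (suc d)) (mkℚ (ℤ.+ n) 0 (coprime-1 n))))
        (ℚᵘ.*≤* (subst₂ ℤ._≤_ (trans (ℤ.pos-* n 1) (cong (ℤ._* ℤ.+ 1) (sym (ℤ.*-identityˡ (ℤ.+ n)))))
                              (ℤ.pos-* c (suc d * 1))
                              (ℤ.+≤+ cross-multiplied)))))
    where
    cross-multiplied : n * 1 ≤ c * (suc d * 1)
    cross-multiplied = begin
      n * 1            ≡⟨ *-identityʳ n ⟩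
      n                ≤⟨ h ⟩
      suc d * c        ≡⟨ trans (*-comm (suc d) c) (cong (c *_) (sym (*-identityʳ (suc d)))) ⟩
      c * (suc d * 1)  ∎
      where open ≤-Reasoning

  ∣tabulate∣ : ∀ {n} (X : Fin n → Bool) → ∣ tabulate X ∣ ≡ count X
  ∣tabulate∣ {zero}  X = refl
  ∣tabulate∣ {suc n} X with X zero
  ... | true  = cong suc (∣tabulate∣ (X ∘ suc))
  ... | false = ∣tabulate∣ (X ∘ suc)

  tabulate-∩ : ∀ {n} (X Y : Fin n → Bool) → tabulate X ∩ tabulate Y ≡ tabulate (λ u → X u ∧ Y u)
  tabulate-∩ {zero}  X Y = refl
  tabulate-∩ {suc n} X Y = cong (X zero ∧ Y zero ∷_) (tabulate-∩ (X ∘ suc) (Y ∘ suc))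

  ∈-tabulate : ∀ {n} (X : Fin n → Bool) v → v ∈ tabulate X → X v ≡ true
  ∈-tabulate X v v∈X = trans (sym (lookup∘tabulate X v)) ([]=⇒lookup v∈X)

  LowDegree⇒AllLowDegree : ∀ {n} (G : OGraph n) E X ε → (∀ d x → E * d < x → ℕtoℚ d <ℚ ε *ℚ ℕtoℚ x) →
    LowDegree G E X → AllLowDegree G (tabulate X) ε
  LowDegree⇒AllLowDegree G E X ε bound low v v∈X =
    subst₂ (λ d x → ℕtoℚ d <ℚ ε *ℚ ℕtoℚ x)
           (sym (trans (cong ∣_∣ (tabulate-∩ X (adj G v))) (∣tabulate∣ (λ u → X u ∧ adj G v u))))
           (sym (∣tabulate∣ X))
           (bound _ _ (low v (∈-tabulate X v v∈X)))

  2P≢0 : ∀ k E .{{_ : NonZero E}} → NonZero (2 * threshold k E)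
  2P≢0 k E = m*n≢0 2 (threshold k E) {{_}} {{threshold≢0 k E}}

  δ : (k E : ℕ) → .{{NonZero E}} → ℚ
  δ k E = inverseℕ (2 * threshold k E) {{2P≢0 k E}}


  δ-positive : ∀ k E .{{_ : NonZero E}} → Positive (δ k E)
  δ-positive k E = inverseℕ-positive (2 * threshold k E) {{2P≢0 k E}}

  homogeneousSubset : ∀ {k} (H : OGraph (suc k)) ε E → (∀ d x → suc E * d < x → ℕtoℚ d <ℚ ε *ℚ ℕtoℚ x) →
    ∀ n (G : OGraph n) → ¬ Contains G H →
    Σ (Subset n) λ X → (δ k (suc E) *ℚ ℕtoℚ n ≤ℚ ℕtoℚ ∣ X ∣) × (AllLowDegree G X ε ⊎ AllLowDegree (complement G) X ε)
  homogeneousSubset {k} H ε E bound n G H⊄G = tabulate X , δn≤|X| , Sum.map (transfer G) (transfer (complement G)) low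
    where
    result = large-HomogeneousSet H (suc E) G H⊄G
    X = proj₁ result
    low = proj₂ (proj₂ result)
    δn≤|X| : δ k (suc E) *ℚ ℕtoℚ n ≤ℚ ℕtoℚ ∣ tabulate X ∣
    δn≤|X| = subst (λ c → δ k (suc E) *ℚ ℕtoℚ n ≤ℚ ℕtoℚ c) (sym (∣tabulate∣ X))
               (inverseℕ-bound (2 * threshold k (suc E)) {{2P≢0 k (suc E)}} n (count X) (proj₁ (proj₂ result)))
    transfer : ∀ G′ → LowDegree G′ (suc E) X → AllLowDegree G′ (tabulate X) ε
    transfer G′ = LowDegree⇒AllLowDegree G′ (suc E) X ε bound

open import Defs
open import Data.Nat using (ℕ; suc)
open import Data.Fin.Subset using (Subset; ∣_∣)
open import Data.Rational using (ℚ; Positive; _≤_; _*_)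
open import Data.Product using (Σ; _×_; _,_)
open import Data.Sum using (_⊎_)
open import Data.Empty using (⊥-elim)
open import Relation.Nullary using (¬_)
open OrderedRödl using (ε-bound; δ; δ-positive; homogeneousSubset)

mainTheorem4 : ∀ {k} (H : OGraph k) (ε : ℚ) → Positive ε →
    Σ ℚ λ δ → Positive δ ×
      (∀ n (G : OGraph n) → ¬ Contains G H →
        Σ (Subset n) λ X → (δ * ℕtoℚ n ≤ ℕtoℚ ∣ X ∣) ×
          (AllLowDegree G X ε ⊎ AllLowDegree (complement G) X ε))
mainTheorem4 {0}     H ε ε>0 = δ 0 1 , δ-positive 0 1 , λ n G H⊄G → ⊥-elim (H⊄G ((λ ()) , (λ ()) , (λ ())))
mainTheorem4 {suc k} H ε ε>0 =
  let E , bound = ε-bound ε ε>0 in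
  δ k (suc E) , δ-positive k (suc E) , homogeneousSubset H ε E bound
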